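{- Let $P\subseteq \mathbb R^n$ be a polyhedron with the integer decomposition property, where $\mathrm{aff}(P) = \{x:Ax=b\}$ for some $A\in \mathbb Z^{m\times n}$, $b\in \mathbb Z^m\setminus \{\mathbf{0}\}$ with $m\geq 1$. Let $g:=\gcd\{b_i:i\in [m]\}$. Then $P\cap \mathbb Z^n$ is a $\frac{1}{g}$-integral generating set for a cone, i.e. every integral vector in the conic hull of $P\cap\mathbb Z^n$ can be written as $\sum_{h}\mu_h h$ over finitely many $h\in P\cap\mathbb Z^n$ with each $\mu_h\in\frac1g\mathbb Z_{\ge0}$.
   Context: For a polyhedron $P$ and $k\ge0$, $kP$ is the set of points $\sum_{p\in P}\lambda_p p$ with $\lambda\ge0$ finitely supported and $\sum_p\lambda_p=k$; $P$ has the integer decomposition property if for every integer $k\ge1$, every integral point of $kP$ is a sum of $k$ integral points of $P$. $\mathrm{aff}$ denotes affine hull.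
   Formalization: P is a rational polyhedron in ℚ^n rather than a polyhedron in ℝ^n, cut out by inequalities with rational data, and the coefficients defining kP, aff(P) and the conic hull are rational. -}

module Defs where

open import Data.Nat as ℕ using (ℕ; zero; suc)
open import Data.Nat.GCD using (gcd)
open import Data.Integer as ℤ using (ℤ; +_)
open import Data.Rational as ℚ using (ℚ; 0ℚ; 1ℚ; _/_)
open import Data.Fin using (Fin; zero; suc)
open import Data.List using (List; []; _∷_)
open import Data.List.Relation.Unary.All using (All)
open import Data.Vec using (Vec)
import Data.Vec as V
open import Data.Product using (Σ; _×_; _,_; ∃)
open import Relation.Binary.PropositionalEquality using (_≡_)

ℚVec : ℕ → Set
ℚVec n = Fin n → ℚ

ℤVec : ℕ → Set
ℤVec n = Fin n → ℤ

ι : ℤ → ℚ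
ι z = z / 1

ιV : ∀ {n} → ℤVec n → ℚVec n
ιV z i = ι (z i)

sumℚ : ∀ {n} → (Fin n → ℚ) → ℚ
sumℚ {zero} f = 0ℚ
sumℚ {suc n} f = f zero ℚ.+ sumℚ (λ i → f (suc i))

dot : ∀ {n} → ℚVec n → ℚVec n → ℚ
dot u v = sumℚ (λ i → u i ℚ.* v i)

dotℤ : ∀ {n} → ℤVec n → ℤVec n → ℤ
dotℤ {zero} u v = + 0
dotℤ {suc n} u v = u zero ℤ.* v zero ℤ.+ dotℤ (λ i → u (suc i)) (λ i → v (suc i))

record Polyhedron (n : ℕ) : Set where
  constructor polyhedron
  field
    rows : ℕ
    C    : Fin rows → ℚVec n
    d    : Fin rows → ℚ

_∈P_ : ∀ {n} → ℚVec n → Polyhedron n → Set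
x ∈P P = ∀ r → dot (Polyhedron.C P r) x ℚ.≤ Polyhedron.d P r

combo : ∀ {n} → List (ℚ × ℚVec n) → ℚVec n
combo [] i = 0ℚ
combo ((c , p) ∷ l) i = c ℚ.* p i ℚ.+ combo l i

weight : ∀ {n} → List (ℚ × ℚVec n) → ℚ
weight [] = 0ℚ
weight ((c , p) ∷ l) = c ℚ.+ weight l

_∈_·P_ : ∀ {n} → ℚVec n → ℚ → Polyhedron n → Set
x ∈ k ·P P = Σ (List (ℚ × ℚVec _)) λ l →
  All (λ cp → (0ℚ ℚ.≤ Data.Product.proj₁ cp) × (Data.Product.proj₂ cp ∈P P)) l
  × weight l ≡ k × (∀ i → combo l i ≡ x i)

sumPts : ∀ {n k} → Vec (ℤVec n) k → ℤVec n
sumPts V.[] i = + 0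
sumPts (h V.∷ hs) i = h i ℤ.+ sumPts hs i

IDP : ∀ {n} → Polyhedron n → Set
IDP {n} P = ∀ (k : ℕ) → 1 ℕ.≤ k → (z : ℤVec n) → ιV z ∈ ι (+ k) ·P P →
  Σ (Vec (ℤVec n) k) λ hs → V.All (λ h → ιV h ∈P P) hs × (∀ i → sumPts hs i ≡ z i)
  where import Data.Vec.Relation.Unary.All as V

_∈aff_ : ∀ {n} → ℚVec n → Polyhedron n → Set
x ∈aff P = Σ (List (ℚ × ℚVec _)) λ l →
  All (λ cp → Data.Product.proj₂ cp ∈P P) l × weight l ≡ 1ℚ × (∀ i → combo l i ≡ x i)

AffHullEq : ∀ {m n} → Polyhedron n → (Fin m → ℤVec n) → (Fin m → ℤ) → Set
AffHullEq {m} {n} P A b = ∀ (x : ℚVec n) →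
  (x ∈aff P → ∀ i → dot (ιV (A i)) x ≡ ι (b i)) × ((∀ i → dot (ιV (A i)) x ≡ ι (b i)) → x ∈aff P)

gcdFin : ∀ {m} → (Fin m → ℤ) → ℕ
gcdFin {zero} b = 0
gcdFin {suc m} b = gcd ℤ.∣ b zero ∣ (gcdFin (λ i → b (suc i)))

comboℤ : ∀ {n} → List (ℚ × ℤVec n) → ℚVec n
comboℤ [] i = 0ℚ
comboℤ ((c , h) ∷ l) i = c ℚ.* ι (h i) ℚ.+ comboℤ l i

InConeIntPts : ∀ {n} → Polyhedron n → ℚVec n → Set
InConeIntPts P x = Σ (List (ℚ × ℤVec _)) λ l →
  All (λ ch → (0ℚ ℚ.≤ Data.Product.proj₁ ch) × (ιV (Data.Product.proj₂ ch) ∈P P)) l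
  × (∀ i → comboℤ l i ≡ x i)

-- μ ∈ (1/g) ℤ_{≥0}, i.e. μ = c/g for some c ∈ ℕ (for g ≠ 0)
InFrac : ℕ → ℚ → Set
InFrac g μ = ∃ λ (c : ℕ) → μ ℚ.* ι (+ g) ≡ ι (+ c)

FracIntGenerating : ∀ {n} → ℕ → Polyhedron n → Set
FracIntGenerating {n} g P = ∀ (z : ℤVec n) → InConeIntPts P (ιV z) →
  Σ (List (ℚ × ℤVec n)) λ l →
    All (λ ch → InFrac g (Data.Product.proj₁ ch) × (ιV (Data.Product.proj₂ ch) ∈P P)) l
    × (∀ i → comboℤ l i ≡ ιV z i)

{-# OPTIONS --safe #-}
module Submission where

-- If z = Σ μ_h h with μ_h ≥ 0 and h ∈ P ∩ ℤⁿ, then every h satisfies A h = b, so A z = k b for the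
-- total weight k = Σ μ_h. Hence k b_i ∈ ℤ for every i, and by Bézout k g ∈ ℤ. Scaling the combination
-- by g puts g z into the dilate (k g)P, so the integer decomposition property writes g z as a sum of
-- k g points of P ∩ ℤⁿ, i.e. z = Σ_j (1/g) h_j. When k g = 0 all μ_h vanish and z = 0.

open import Defs
open import Data.Nat as ℕ using (ℕ; _≤_; zero; suc; s≤s; z≤n)
open import Data.Nat.GCD as GCD using (gcd)
import Data.Nat.Coprimality as Coprimality
open import Data.Integer as ℤ using (ℤ; +_; -[1+_])
import Data.Integer.Properties as ℤP
import Data.Integer.Solver as ℤ-Solver
open import Data.Rational as ℚ using (ℚ; mkℚ; 0ℚ; 1ℚ; _+_; _*_; _/_)
import Data.Rational.Properties as ℚP
import Data.Rational.Solver as ℚ-Solver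
open import Data.Fin using (Fin; zero; suc)
open import Data.List using (List; []; _∷_)
open import Data.List.Relation.Unary.All as All using (All; []; _∷_)
open import Data.Vec as Vec using (Vec)
import Data.Vec.Relation.Unary.All as VecAll
open import Data.Product using (Σ; ∃; ∃₂; _×_; _,_; proj₁; proj₂)
open import Data.Empty using (⊥-elim)
open import Relation.Nullary using (¬_)
open import Relation.Binary.PropositionalEquality
  using (_≡_; refl; sym; trans; cong; cong₂; subst; module ≡-Reasoning)

coprimeTo-1 : ∀ z → Coprimality.Coprime ℤ.∣ z ∣ 1
coprimeTo-1 z = Coprimality.sym (Coprimality.1-coprimeTo ℤ.∣ z ∣)

ι≡mkℚ : ∀ z → ι z ≡ mkℚ z 0 (coprimeTo-1 z)
ι≡mkℚ (+ n)    = ℚP.normalize-coprime (coprimeTo-1 (+ n))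
ι≡mkℚ -[1+ n ] = cong ℚ.-_ (ℚP.normalize-coprime (coprimeTo-1 -[1+ n ]))

-- Once ι x and ι y are rewritten to normal form, ℚ's _+_ and _*_ compute to (x * 1 + y * 1) / 1
-- and (x * y) / 1.
ι-homo-+ : ∀ x y → ι (x ℤ.+ y) ≡ ι x + ι y
ι-homo-+ x y rewrite ι≡mkℚ x | ι≡mkℚ y =
  sym (cong₂ (λ a b → (a ℤ.+ b) / 1) (ℤP.*-identityʳ x) (ℤP.*-identityʳ y))

ι-homo-* : ∀ x y → ι (x ℤ.* y) ≡ ι x * ι y
ι-homo-* x y rewrite ι≡mkℚ x | ι≡mkℚ y = refl

ι-suc-invertible : ∀ g → ∃ λ r → r * ι (+ suc g) ≡ 1ℚ
ι-suc-invertible g rewrite ι≡mkℚ (+ suc g) = ℚ.1/ γ , ℚP.*-inverseˡ γ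
  where γ = mkℚ (+ suc g) 0 (coprimeTo-1 (+ suc g))

ι-suc-cancelʳ : ∀ g {p q} → p * ι (+ suc g) ≡ q * ι (+ suc g) → p ≡ q
ι-suc-cancelʳ g e rewrite ι≡mkℚ (+ suc g) =
  ℚP.≤-antisym (ℚP.*-cancelʳ-≤-pos _ (ℚP.≤-reflexive e)) (ℚP.*-cancelʳ-≤-pos _ (ℚP.≤-reflexive (sym e)))

0≤ι+ : ∀ n → 0ℚ ℚ.≤ ι (+ n)
0≤ι+ n rewrite ι≡mkℚ (+ n) = ℚP.nonNegative⁻¹ _

0≤ι⇒0≤ : ∀ {z} → 0ℚ ℚ.≤ ι z → ℤ.0ℤ ℤ.≤ z
0≤ι⇒0≤ {z} 0≤ιz with ℚ.*≤* 0≤z*1 ← subst (0ℚ ℚ.≤_) (ι≡mkℚ z) 0≤ιz =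
  subst (ℤ.0ℤ ℤ.≤_) (ℤP.*-identityʳ z) 0≤z*1

IsInt : ℚ → Set
IsInt q = ∃ λ N → q ≡ ι N

nonNeg∧IsInt⇒ℕ : ∀ {q} → 0ℚ ℚ.≤ q → IsInt q → ∃ λ K → q ≡ ι (+ K)
nonNeg∧IsInt⇒ℕ 0≤q (N , q≡ιN) =
  ℤ.∣ N ∣ , trans q≡ιN (cong ι (sym (ℤP.0≤i⇒+∣i∣≡i (0≤ι⇒0≤ {N} (subst (0ℚ ℚ.≤_) q≡ιN 0≤q)))))

module _ (k : ℚ) where
  open ≡-Reasoning

  integralMultiple-+ : ∀ a b → IsInt (k * ι a) → IsInt (k * ι b) → IsInt (k * ι (a ℤ.+ b))
  integralMultiple-+ a b (M , ka≡ιM) (N , kb≡ιN) = M ℤ.+ N , (begin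
    k * ι (a ℤ.+ b)    ≡⟨ cong (k *_) (ι-homo-+ a b) ⟩
    k * (ι a + ι b)    ≡⟨ ℚP.*-distribˡ-+ k (ι a) (ι b) ⟩
    k * ι a + k * ι b  ≡⟨ cong₂ _+_ ka≡ιM kb≡ιN ⟩
    ι M + ι N          ≡⟨ ι-homo-+ M N ⟨
    ι (M ℤ.+ N)        ∎)

  integralMultiple-* : ∀ x a → IsInt (k * ι a) → IsInt (k * ι (x ℤ.* a))
  integralMultiple-* x a (N , ka≡ιN) = x ℤ.* N , (begin
    k * ι (x ℤ.* a)    ≡⟨ cong (k *_) (ι-homo-* x a) ⟩
    k * (ι x * ι a)    ≡⟨ ℚP.*-assoc k (ι x) (ι a) ⟨
    (k * ι x) * ι a    ≡⟨ cong (_* ι a) (ℚP.*-comm k (ι x)) ⟩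
    (ι x * k) * ι a    ≡⟨ ℚP.*-assoc (ι x) k (ι a) ⟩
    ι x * (k * ι a)    ≡⟨ cong (ι x *_) ka≡ιN ⟩
    ι x * ι N          ≡⟨ ι-homo-* x N ⟨
    ι (x ℤ.* N)        ∎)

  integralMultiple-∣∣ : ∀ z → IsInt (k * ι z) → IsInt (k * ι (+ ℤ.∣ z ∣))
  integralMultiple-∣∣ (+ n)    kz∈ℤ = kz∈ℤ
  integralMultiple-∣∣ -[1+ n ] kz∈ℤ =
    subst (λ t → IsInt (k * ι t)) (ℤP.-1*i≡-i -[1+ n ]) (integralMultiple-* ℤ.-1ℤ -[1+ n ] kz∈ℤ)

bézout-ℕ⇒ℤ : ∀ d x y a b → d ℕ.+ y ℕ.* b ≡ x ℕ.* a → + d ≡ + x ℤ.* + a ℤ.+ ℤ.- + y ℤ.* + b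
bézout-ℕ⇒ℤ d x y a b d+yb≡xa = begin
  + d                                        ≡⟨ D≡D+YB-YB (+ d) (+ y) (+ b) ⟩
  (+ d ℤ.+ + y ℤ.* + b) ℤ.+ ℤ.- + y ℤ.* + b  ≡⟨ cong (ℤ._+ ℤ.- + y ℤ.* + b) d+yb≡xa′ ⟩
  + x ℤ.* + a ℤ.+ ℤ.- + y ℤ.* + b            ∎
  where
  open ≡-Reasoning
  open ℤ-Solver.+-*-Solver
  D≡D+YB-YB : ∀ D Y B → D ≡ (D ℤ.+ Y ℤ.* B) ℤ.+ ℤ.- Y ℤ.* B
  D≡D+YB-YB = solve 3 (λ D Y B → D := (D :+ Y :* B) :+ :- Y :* B) refl
  d+yb≡xa′ : + d ℤ.+ + y ℤ.* + b ≡ + x ℤ.* + a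
  d+yb≡xa′ = begin
    + d ℤ.+ + y ℤ.* + b  ≡⟨ cong (ℤ._+_ (+ d)) (ℤP.pos-* y b) ⟨
    + d ℤ.+ + (y ℕ.* b)  ≡⟨ ℤP.pos-+ d (y ℕ.* b) ⟨
    + (d ℕ.+ y ℕ.* b)    ≡⟨ cong +_ d+yb≡xa ⟩
    + (x ℕ.* a)          ≡⟨ ℤP.pos-* x a ⟩
    + x ℤ.* + a          ∎

bézoutℤ : ∀ a b → ∃₂ λ x y → + gcd a b ≡ x ℤ.* + a ℤ.+ y ℤ.* + b
bézoutℤ a b with GCD.Bézout.identity (GCD.gcd-GCD a b)
... | GCD.Bézout.+- x y d+yb≡xa = + x , ℤ.- + y , bézout-ℕ⇒ℤ _ x y a b d+yb≡xa
... | GCD.Bézout.-+ x y d+xa≡yb =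
  ℤ.- + x , + y , trans (bézout-ℕ⇒ℤ _ y x b a d+xa≡yb) (ℤP.+-comm (+ y ℤ.* + b) _)

integralMultiple-gcd : ∀ k a b → IsInt (k * ι (+ a)) → IsInt (k * ι (+ b)) → IsInt (k * ι (+ gcd a b))
integralMultiple-gcd k a b ka∈ℤ kb∈ℤ with x , y , g≡xa+yb ← bézoutℤ a b =
  subst (λ t → IsInt (k * ι t)) (sym g≡xa+yb)
    (integralMultiple-+ k (x ℤ.* + a) (y ℤ.* + b)
      (integralMultiple-* k x (+ a) ka∈ℤ) (integralMultiple-* k y (+ b) kb∈ℤ))

integralMultiple-gcdFin : ∀ {m} k (b : Fin m → ℤ) → (∀ i → IsInt (k * ι (b i))) → IsInt (k * ι (+ gcdFin b))
integralMultiple-gcdFin {zero}  k b kb∈ℤ = + 0 , ℚP.*-zeroʳ k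
integralMultiple-gcdFin {suc m} k b kb∈ℤ =
  integralMultiple-gcd k ℤ.∣ b zero ∣ (gcdFin (λ i → b (suc i))) (integralMultiple-∣∣ k (b zero) (kb∈ℤ zero))
    (integralMultiple-gcdFin k (λ i → b (suc i)) (λ i → kb∈ℤ (suc i)))

gcdFin≡0⇒≡0 : ∀ {m} (b : Fin m → ℤ) → gcdFin b ≡ 0 → ∀ i → b i ≡ + 0
gcdFin≡0⇒≡0 b g≡0 zero    = ℤP.∣i∣≡0⇒i≡0 (GCD.gcd[m,n]≡0⇒m≡0 g≡0)
gcdFin≡0⇒≡0 b g≡0 (suc i) = gcdFin≡0⇒≡0 (λ j → b (suc j)) (GCD.gcd[m,n]≡0⇒n≡0 ℤ.∣ b zero ∣ g≡0) i

dot-congʳ : ∀ {n} (u : ℚVec n) {x y : ℚVec n} → (∀ i → x i ≡ y i) → dot u x ≡ dot u y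
dot-congʳ {zero}  u x≗y = refl
dot-congʳ {suc n} u x≗y =
  cong₂ _+_ (cong (u zero *_) (x≗y zero)) (dot-congʳ (λ i → u (suc i)) (λ i → x≗y (suc i)))

dot-zeroʳ : ∀ {n} (u : ℚVec n) → dot u (λ _ → 0ℚ) ≡ 0ℚ
dot-zeroʳ {zero}  u = refl
dot-zeroʳ {suc n} u = cong₂ _+_ (ℚP.*-zeroʳ (u zero)) (dot-zeroʳ (λ i → u (suc i)))

dot-linearʳ : ∀ {n} (u x y : ℚVec n) c → dot u (λ i → c * x i + y i) ≡ c * dot u x + dot u y
dot-linearʳ {zero}  u x y c = sym (trans (ℚP.+-identityʳ (c * 0ℚ)) (ℚP.*-zeroʳ c))
dot-linearʳ {suc n} u x y c = begin
  u₀ * (c * x zero + y zero) + dot u′ (λ i → c * x′ i + y′ i)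
    ≡⟨ cong (λ t → u₀ * (c * x zero + y zero) + t) (dot-linearʳ u′ x′ y′ c) ⟩
  u₀ * (c * x zero + y zero) + (c * dot u′ x′ + dot u′ y′)
    ≡⟨ regroup u₀ c (x zero) (y zero) (dot u′ x′) (dot u′ y′) ⟩
  c * (u₀ * x zero + dot u′ x′) + (u₀ * y zero + dot u′ y′) ∎
  where
  open ≡-Reasoning
  open ℚ-Solver.+-*-Solver
  u₀ = u zero
  u′ x′ y′ : ℚVec n
  u′ i = u (suc i)
  x′ i = x (suc i)
  y′ i = y (suc i)
  regroup : ∀ u c x y D E → u * (c * x + y) + (c * D + E) ≡ c * (u * x + D) + (u * y + E)
  regroup = solve 6 (λ u c x y D E → u :* (c :* x :+ y) :+ (c :* D :+ E) := c :* (u :* x :+ D) :+ (u :* y :+ E)) refl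

dot-ι : ∀ {n} (a z : ℤVec n) → dot (ιV a) (ιV z) ≡ ι (dotℤ a z)
dot-ι {zero}  a z = refl
dot-ι {suc n} a z = begin
  ι (a zero) * ι (z zero) + dot (ιV a′) (ιV z′) ≡⟨ cong₂ _+_ (sym (ι-homo-* (a zero) (z zero))) (dot-ι a′ z′) ⟩
  ι (a zero ℤ.* z zero) + ι (dotℤ a′ z′)        ≡⟨ ι-homo-+ (a zero ℤ.* z zero) (dotℤ a′ z′) ⟨
  ι (a zero ℤ.* z zero ℤ.+ dotℤ a′ z′)          ∎
  where
  open ≡-Reasoning
  a′ z′ : ℤVec n
  a′ i = a (suc i)
  z′ i = z (suc i)

weightℤ : ∀ {n} → List (ℚ × ℤVec n) → ℚ
weightℤ []            = 0ℚ
weightℤ ((c , _) ∷ l) = c + weightℤ l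

dot-comboℤ : ∀ {n} (u : ℚVec n) β (l : List (ℚ × ℤVec n)) →
  All (λ ch → dot u (ιV (proj₂ ch)) ≡ β) l → dot u (comboℤ l) ≡ weightℤ l * β
dot-comboℤ u β []            []       = trans (dot-zeroʳ u) (sym (ℚP.*-zeroˡ β))
dot-comboℤ u β ((c , h) ∷ l) (uh≡β ∷ ul≡β) = begin
  dot u (λ i → c * ι (h i) + comboℤ l i)  ≡⟨ dot-linearʳ u (ιV h) (comboℤ l) c ⟩
  c * dot u (ιV h) + dot u (comboℤ l)     ≡⟨ cong₂ (λ s t → c * s + t) uh≡β (dot-comboℤ u β l ul≡β) ⟩
  c * β + weightℤ l * β                   ≡⟨ ℚP.*-distribʳ-+ β c (weightℤ l) ⟨
  (c + weightℤ l) * β                     ∎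
  where open ≡-Reasoning

∈P⇒∈aff : ∀ {n} {P : Polyhedron n} {x} → x ∈P P → x ∈aff P
∈P⇒∈aff {x = x} x∈P =
  (1ℚ , x) ∷ [] , x∈P ∷ [] , ℚP.+-identityʳ 1ℚ , λ i → trans (ℚP.+-identityʳ _) (ℚP.*-identityˡ (x i))

module _ {m n} (P : Polyhedron n) (A : Fin m → ℤVec n) (b : Fin m → ℤ) (aff : AffHullEq P A b) where

  ∈P⇒Ax≡b : ∀ {x} → x ∈P P → ∀ i → dot (ιV (A i)) x ≡ ι (b i)
  ∈P⇒Ax≡b {x} x∈P = proj₁ (aff x) (∈P⇒∈aff {P = P} x∈P)

  comboℤ-Ax≡weight*b : ∀ l → All (λ ch → ιV (proj₂ ch) ∈P P) l →
    ∀ i → dot (ιV (A i)) (comboℤ l) ≡ weightℤ l * ι (b i)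
  comboℤ-Ax≡weight*b l l∈P i = dot-comboℤ (ιV (A i)) (ι (b i)) l (All.map (λ h∈P → ∈P⇒Ax≡b h∈P i) l∈P)

0≤p*q : ∀ {p q} → 0ℚ ℚ.≤ p → 0ℚ ℚ.≤ q → 0ℚ ℚ.≤ p * q
0≤p*q {p} {q} 0≤p 0≤q =
  ℚP.nonNegative⁻¹ (p * q) {{ℚP.nonNeg*nonNeg⇒nonNeg p {{ℚ.nonNegative 0≤p}} q {{ℚ.nonNegative 0≤q}}}}

p+q≡0⇒p≡0 : ∀ {p q} → 0ℚ ℚ.≤ p → 0ℚ ℚ.≤ q → p + q ≡ 0ℚ → p ≡ 0ℚ
p+q≡0⇒p≡0 {p} {q} 0≤p 0≤q p+q≡0 = ℚP.≤-antisym p≤0 0≤p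
  where
  open ℚP.≤-Reasoning
  p≤0 : p ℚ.≤ 0ℚ
  p≤0 = begin
    p       ≡⟨ ℚP.+-identityʳ p ⟨
    p + 0ℚ  ≤⟨ ℚP.+-monoʳ-≤ p 0≤q ⟩
    p + q   ≡⟨ p+q≡0 ⟩
    0ℚ      ∎

NonNegCoeffs : ∀ {n} → List (ℚ × ℤVec n) → Set
NonNegCoeffs = All (λ ch → 0ℚ ℚ.≤ proj₁ ch)

weightℤ-nonNeg : ∀ {n} (l : List (ℚ × ℤVec n)) → NonNegCoeffs l → 0ℚ ℚ.≤ weightℤ l
weightℤ-nonNeg []      []          = ℚP.≤-refl
weightℤ-nonNeg (_ ∷ l) (0≤c ∷ 0≤l) = ℚP.+-mono-≤ 0≤c (weightℤ-nonNeg l 0≤l)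

weightℤ≡0⇒comboℤ≡0 : ∀ {n} (l : List (ℚ × ℤVec n)) → NonNegCoeffs l → weightℤ l ≡ 0ℚ → ∀ i → comboℤ l i ≡ 0ℚ
weightℤ≡0⇒comboℤ≡0 []            []          _     i = refl
weightℤ≡0⇒comboℤ≡0 ((c , h) ∷ l) (0≤c ∷ 0≤l) w≡0 i = begin
  c * ι (h i) + comboℤ l i  ≡⟨ cong₂ (λ s t → s * ι (h i) + t) c≡0 (weightℤ≡0⇒comboℤ≡0 l 0≤l wl≡0 i) ⟩
  0ℚ * ι (h i) + 0ℚ         ≡⟨ ℚP.+-identityʳ _ ⟩
  0ℚ * ι (h i)              ≡⟨ ℚP.*-zeroˡ (ι (h i)) ⟩
  0ℚ                        ∎
  where
  open ≡-Reasoning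
  0≤wl = weightℤ-nonNeg l 0≤l
  c≡0 : c ≡ 0ℚ
  c≡0 = p+q≡0⇒p≡0 0≤c 0≤wl w≡0
  wl≡0 : weightℤ l ≡ 0ℚ
  wl≡0 = p+q≡0⇒p≡0 0≤wl 0≤c (trans (ℚP.+-comm (weightℤ l) c) w≡0)

ConicTerms : ∀ {n} → Polyhedron n → List (ℚ × ℤVec n) → Set
ConicTerms P = All (λ ch → (0ℚ ℚ.≤ proj₁ ch) × (ιV (proj₂ ch) ∈P P))

scaleToℚ : ∀ {n} → ℚ → List (ℚ × ℤVec n) → List (ℚ × ℚVec n)
scaleToℚ γ []            = []
scaleToℚ γ ((c , h) ∷ l) = (γ * c , ιV h) ∷ scaleToℚ γ l

weight-scaleToℚ : ∀ {n} γ (l : List (ℚ × ℤVec n)) → weight (scaleToℚ γ l) ≡ γ * weightℤ l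
weight-scaleToℚ γ []            = sym (ℚP.*-zeroʳ γ)
weight-scaleToℚ γ ((c , h) ∷ l) =
  trans (cong (λ t → γ * c + t) (weight-scaleToℚ γ l)) (sym (ℚP.*-distribˡ-+ γ c (weightℤ l)))

combo-scaleToℚ : ∀ {n} γ (l : List (ℚ × ℤVec n)) i → combo (scaleToℚ γ l) i ≡ γ * comboℤ l i
combo-scaleToℚ γ []            i = sym (ℚP.*-zeroʳ γ)
combo-scaleToℚ γ ((c , h) ∷ l) i = begin
  γ * c * ι (h i) + combo (scaleToℚ γ l) i  ≡⟨ cong₂ _+_ (ℚP.*-assoc γ c (ι (h i))) (combo-scaleToℚ γ l i) ⟩
  γ * (c * ι (h i)) + γ * comboℤ l i        ≡⟨ ℚP.*-distribˡ-+ γ (c * ι (h i)) (comboℤ l i) ⟨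
  γ * (c * ι (h i) + comboℤ l i)            ∎
  where open ≡-Reasoning

scaleToℚ-terms : ∀ {n} (P : Polyhedron n) γ → 0ℚ ℚ.≤ γ → ∀ l → ConicTerms P l →
  All (λ cp → (0ℚ ℚ.≤ proj₁ cp) × (proj₂ cp ∈P P)) (scaleToℚ γ l)
scaleToℚ-terms P γ 0≤γ []      []                 = []
scaleToℚ-terms P γ 0≤γ (_ ∷ l) ((0≤c , h∈P) ∷ l∈) =
  (0≤p*q 0≤γ 0≤c , h∈P) ∷ scaleToℚ-terms P γ 0≤γ l l∈

conic-scaled-∈·P : ∀ {n} (P : Polyhedron n) γ {k} {y : ℚVec n} (l : List (ℚ × ℤVec n)) →
  0ℚ ℚ.≤ γ → ConicTerms P l → γ * weightℤ l ≡ k → (∀ i → γ * comboℤ l i ≡ y i) → y ∈ k ·P P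
conic-scaled-∈·P P γ l 0≤γ l∈ γw≡k γl≡y =
  scaleToℚ γ l , scaleToℚ-terms P γ 0≤γ l l∈ , trans (weight-scaleToℚ γ l) γw≡k ,
  λ i → trans (combo-scaleToℚ γ l i) (γl≡y i)

withCoeff : ∀ {n k} → ℚ → Vec (ℤVec n) k → List (ℚ × ℤVec n)
withCoeff c Vec.[]       = []
withCoeff c (h Vec.∷ hs) = (c , h) ∷ withCoeff c hs

comboℤ-withCoeff : ∀ {n k} c (hs : Vec (ℤVec n) k) i → comboℤ (withCoeff c hs) i ≡ c * ι (sumPts hs i)
comboℤ-withCoeff c Vec.[]       i = sym (ℚP.*-zeroʳ c)
comboℤ-withCoeff c (h Vec.∷ hs) i = begin
  c * ι (h i) + comboℤ (withCoeff c hs) i  ≡⟨ cong (λ t → c * ι (h i) + t) (comboℤ-withCoeff c hs i) ⟩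
  c * ι (h i) + c * ι (sumPts hs i)        ≡⟨ ℚP.*-distribˡ-+ c (ι (h i)) (ι (sumPts hs i)) ⟨
  c * (ι (h i) + ι (sumPts hs i))          ≡⟨ cong (c *_) (ι-homo-+ (h i) (sumPts hs i)) ⟨
  c * ι (h i ℤ.+ sumPts hs i)              ∎
  where open ≡-Reasoning

withCoeff-terms : ∀ {n k} {C : ℚ → Set} {H : ℤVec n → Set} {c} → C c → {hs : Vec (ℤVec n) k} →
  VecAll.All H hs → All (λ ch → C (proj₁ ch) × H (proj₂ ch)) (withCoeff c hs)
withCoeff-terms Cc VecAll.[]         = []
withCoeff-terms Cc (Hh VecAll.∷ Hhs) = (Cc , Hh) ∷ withCoeff-terms Cc Hhs

FracCombination : ∀ {n} → ℕ → Polyhedron n → ℤVec n → Set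
FracCombination {n} g P z = Σ (List (ℚ × ℤVec n)) λ l →
  All (λ ch → InFrac g (proj₁ ch) × (ιV (proj₂ ch) ∈P P)) l × (∀ i → comboℤ l i ≡ ιV z i)

decomposition⇒fracCombination : ∀ {n k} (P : Polyhedron n) g (z : ℤVec n) (hs : Vec (ℤVec n) k) →
  VecAll.All (λ h → ιV h ∈P P) hs → (∀ i → sumPts hs i ≡ + suc g ℤ.* z i) → FracCombination (suc g) P z
decomposition⇒fracCombination P g z hs hs∈P Σhs≡gz =
  withCoeff r hs , withCoeff-terms (1 , r*γ≡1) hs∈P , λ i → begin
    comboℤ (withCoeff r hs) i   ≡⟨ comboℤ-withCoeff r hs i ⟩
    r * ι (sumPts hs i)          ≡⟨ cong (λ t → r * ι t) (Σhs≡gz i) ⟩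
    r * ι (+ suc g ℤ.* z i)      ≡⟨ cong (r *_) (ι-homo-* (+ suc g) (z i)) ⟩
    r * (γ * ι (z i))            ≡⟨ ℚP.*-assoc r γ (ι (z i)) ⟨
    r * γ * ι (z i)              ≡⟨ cong (_* ι (z i)) r*γ≡1 ⟩
    1ℚ * ι (z i)                 ≡⟨ ℚP.*-identityˡ (ι (z i)) ⟩
    ι (z i)                      ∎
  where
  open ≡-Reasoning
  γ = ι (+ suc g)
  r = proj₁ (ι-suc-invertible g)
  r*γ≡1 = proj₂ (ι-suc-invertible g)

IDP⇒fracCombination⁺ : ∀ {n} (P : Polyhedron n) → IDP P → ∀ g K (z : ℤVec n) l →
  ConicTerms P l → (∀ i → comboℤ l i ≡ ιV z i) → weightℤ l * ι (+ suc g) ≡ ι (+ suc K) →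
  FracCombination (suc g) P z
IDP⇒fracCombination⁺ {n} P idp g K z l l∈ l≡z wγ≡K =
  let hs , hs∈P , Σhs≡gz = idp (suc K) (s≤s z≤n) gz gz∈KP
  in decomposition⇒fracCombination P g z hs hs∈P Σhs≡gz
  where
  γ = ι (+ suc g)
  gz : ℤVec n
  gz i = + suc g ℤ.* z i
  gz∈KP : ιV gz ∈ ι (+ suc K) ·P P
  gz∈KP = conic-scaled-∈·P P γ l (0≤ι+ (suc g)) l∈ (trans (ℚP.*-comm γ (weightℤ l)) wγ≡K)
            (λ i → trans (cong (γ *_) (l≡z i)) (sym (ι-homo-* (+ suc g) (z i))))

IDP⇒fracCombination : ∀ {n} (P : Polyhedron n) → IDP P → ∀ g (z : ℤVec n) l →
  ConicTerms P l → (∀ i → comboℤ l i ≡ ιV z i) → IsInt (weightℤ l * ι (+ suc g)) →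
  FracCombination (suc g) P z
IDP⇒fracCombination P idp g z l l∈ l≡z wγ∈ℤ with nonNeg∧IsInt⇒ℕ 0≤wγ wγ∈ℤ
  where 0≤wγ = 0≤p*q (weightℤ-nonNeg l (All.map proj₁ l∈)) (0≤ι+ (suc g))
... | suc K , wγ≡K = IDP⇒fracCombination⁺ P idp g K z l l∈ l≡z wγ≡K
... | zero  , wγ≡0 = [] , [] , λ i → trans (sym (weightℤ≡0⇒comboℤ≡0 l (All.map proj₁ l∈) w≡0 i)) (l≡z i)
  where
  w≡0 : weightℤ l ≡ 0ℚ
  w≡0 = ι-suc-cancelʳ g (trans wγ≡0 (sym (ℚP.*-zeroˡ (ι (+ suc g)))))

mainTheorem10 : ∀ (m n : ℕ) (P : Polyhedron n) (A : Fin m → ℤVec n) (b : Fin m → ℤ) →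
    1 ≤ m → ¬ (∀ i → b i ≡ + 0) → IDP P → AffHullEq P A b →
    FracIntGenerating (gcdFin b) P
mainTheorem10 m n P A b _ b≢0 idp aff z (l , l∈ , l≡z) with gcdFin b in gcd≡
... | zero  = ⊥-elim (b≢0 (gcdFin≡0⇒≡0 b gcd≡))
... | suc g = IDP⇒fracCombination P idp g z l l∈ l≡z
                (subst (λ d → IsInt (weightℤ l * ι (+ d))) gcd≡ (integralMultiple-gcdFin (weightℤ l) b wb∈ℤ))
  where
  wb∈ℤ : ∀ i → IsInt (weightℤ l * ι (b i))
  wb∈ℤ i = dotℤ (A i) z , (begin
    weightℤ l * ι (b i)          ≡⟨ comboℤ-Ax≡weight*b P A b aff l (All.map proj₂ l∈) i ⟨
    dot (ιV (A i)) (comboℤ l)    ≡⟨ dot-congʳ (ιV (A i)) l≡z ⟩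
    dot (ιV (A i)) (ιV z)        ≡⟨ dot-ι (A i) z ⟩
    ι (dotℤ (A i) z)             ∎)
    where open ≡-Reasoning
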